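{- Let $P=\mathbf{a_1}\oplus\mathbf{a_2}\oplus\cdots\oplus\mathbf{a_n}$ and $I\in\mathcal{IC}(P)$. Then \[\mathrm{Row}(I)=\begin{cases} P-I & \text{if } I=\emptyset,\ \mathbf{a_n}\subseteq I,\ \text{or } I\subseteq\mathbf{a_n},\\ \Delta(\mathrm{Ceil}(I))-\Delta(\mathrm{Min}(I)) & \text{otherwise.}\end{cases}\]
   Context: $\mathbf{a}$ denotes an antichain poset with $a\ge1$ elements; $\oplus$ is ordinal sum ($P\oplus Q$ has ground set $P\sqcup Q$ with every element of $P$ below every element of $Q$, original orders kept within $P$ and $Q$). A subset $I$ is interval-closed if whenever $x,y\in I$ and $x\le z\le y$, then $z\in I$; $\mathcal{IC}(P)$ is the set of interval-closed subsets. The toggle $t_x$ sends $I$ to $I\triangle\{x\}$ if this set is interval-closed, and to $I$ otherwise; rowmotion is $\mathrm{Row}=t_{x_1}\circ\cdots\circ t_{x_N}$ for a linear extension $(x_1,\dots,x_N)$ of $P$ (independent of the choice). For $S\subseteq P$, $\Delta(S)$ and $\nabla(S)$ are the order ideal and order filter generated by $S$; $\mathrm{Min}(I)$ is the set of minimal elements of $I$; $\mathrm{Ceil}(I)$ is the set of minimal elements of $\nabla(I)-I$. -}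

module Defs where

open import Data.Nat using (ℕ; suc)
open import Data.Fin using (Fin; _<_; fromℕ)
open import Data.Fin.Properties using (all?; <-cmp) renaming (_≟_ to _≟ᶠ_)
import Data.Fin.Properties as FinP
open import Data.Bool using (Bool; true; false; not; if_then_else_)
open import Data.Product using (Σ; ∃; _×_; _,_; proj₁; proj₂)
open import Data.Product.Properties using (≡-dec)
open import Data.Sum using (_⊎_; inj₁; inj₂)
open import Data.List using (List; concatMap; map)
import Data.List as L
open import Data.Fin.Base using (toℕ)
open import Relation.Nullary using (Dec; yes; no; ¬_)
open import Relation.Nullary.Decidable using (map′; _→-dec_; _⊎-dec_; _×-dec_)
open import Relation.Binary.PropositionalEquality using (_≡_; refl)
open import Data.Bool.Properties using () renaming (_≟_ to _≟ᵇ_)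
open import Data.List using (allFin)

-- The poset P = a₀ ⊕ a₁ ⊕ ⋯ ⊕ a_m  (n = m+1 antichain summands, a i elements in summand i).
module Poset (m : ℕ) (a : Fin (suc m) → ℕ) where

  Elem : Set
  Elem = Σ (Fin (suc m)) (λ i → Fin (a i))

  level : Elem → Fin (suc m)
  level = proj₁

  _≟_ : (x y : Elem) → Dec (x ≡ y)
  _≟_ = ≡-dec _≟ᶠ_ (λ {i} → _≟ᶠ_)

  _≤_ : Elem → Elem → Set
  x ≤ y = (x ≡ y) ⊎ (level x < level y)

  _≤?_ : (x y : Elem) → Dec (x ≤ y)
  x ≤? y = (x ≟ y) ⊎-dec (level x FinP.<? level y)

  Subset : Set
  Subset = Elem → Bool

  _∈_ : Elem → Subset → Set
  x ∈ I = I x ≡ true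

  IsIC : Subset → Set
  IsIC I = ∀ x y z → x ∈ I → y ∈ I → x ≤ z → z ≤ y → z ∈ I

  ∀Elem? : {Q : Elem → Set} → (∀ x → Dec (Q x)) → Dec (∀ x → Q x)
  ∀Elem? {Q} Q? = map′ (λ h x → h (proj₁ x) (proj₂ x)) (λ h i j → h (i , j))
                       (all? (λ i → all? (λ j → Q? (i , j))))

  isIC? : (I : Subset) → Dec (IsIC I)
  isIC? I = ∀Elem? λ x → ∀Elem? λ y → ∀Elem? λ z →
              (I x ≟ᵇ true) →-dec ((I y ≟ᵇ true) →-dec ((x ≤? z) →-dec ((z ≤? y) →-dec (I z ≟ᵇ true))))

  flipAt : Elem → Subset → Subset
  flipAt x I y with y ≟ x
  ... | yes _ = not (I y)
  ... | no _  = I y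

  toggle : Elem → Subset → Subset
  toggle x I with isIC? (flipAt x I)
  ... | yes _ = flipAt x I
  ... | no _  = I

  linExt : List Elem
  linExt = concatMap (λ i → map (λ j → (i , j)) (allFin (a i))) (allFin (suc m))

  -- Row = t_{x₁} ∘ ⋯ ∘ t_{x_N}  (t_{x_N} is applied first).
  Row : Subset → Subset
  Row I = L.foldr toggle I linExt

  Δ : (Elem → Set) → Elem → Set
  Δ S z = ∃ λ s → S s × z ≤ s

  ∇ : (Elem → Set) → Elem → Set
  ∇ S z = ∃ λ s → S s × s ≤ z

  Min : Subset → Elem → Set
  Min I x = x ∈ I × (∀ y → y ∈ I → y ≤ x → y ≡ x)

  Ceil : Subset → Elem → Set
  Ceil I x = (∇ (_∈ I) x × ¬ (x ∈ I))
           × (∀ y → ∇ (_∈ I) y → ¬ (y ∈ I) → y ≤ x → y ≡ x)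

  top : Fin (suc m)
  top = fromℕ m

  SpecialCase : Subset → Set
  SpecialCase I = (∀ x → I x ≡ false)
                ⊎ ((∀ j → (top , j) ∈ I)
                ⊎ (∀ x → x ∈ I → level x ≡ top))

module Submission where

-- Elements of different summands are comparable and elements of one summand are not, so
-- interval-closedness only compares ranks (summand indices). Toggling x ∈ J is legal unless J
-- has elements of both smaller and larger rank, toggling x ∉ J is legal iff J ∪ {x} stays
-- interval-closed, and toggles within one rank do not interact. As Row toggles rank by rank
-- from the top, x of rank k lies in Row I iff this rule holds for I below k and Row I above k,
-- a recursion with a unique solution. So it suffices to check that P − I (in the special
-- cases) and Δ(Ceil I) − Δ(Min I) (otherwise) satisfy it. In the latter case I fills all ranks
-- strictly between its lowest rank L and the rank C of Ceil I, and both sets are read off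
-- from L and C.

open import Defs
open import Data.Nat using (ℕ; zero; suc; _+_; _≤_; _<_; z≤n; s≤s)
import Data.Nat as ℕ
open import Data.Nat.Properties
  using (<⇒≢; <⇒≤; <⇒≱; ≮⇒≥; ≤∧≢⇒<; <-irrefl; <-asym; <-trans; ≤-reflexive; ≤-trans;
         ≤-<-trans; <-≤-trans; <-cmp; m<n⇒m<1+n; m<1+n⇒m≤n; m≤n⇒m<n∨m≡n; +-suc; +-identityʳ;
         anyUpTo?; ≤-antisym; _<?_)
open import Data.Fin using (Fin; toℕ; fromℕ<)
import Data.Fin.Properties as Fin
open import Data.Bool using (Bool; true; false; not)
open import Data.Bool.Properties using (⇔→≡; ¬-not; not-¬; T-≡; T-not-≡)
open import Data.Product using (_×_; _,_; ∃; proj₁; proj₂)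
open import Data.Sum using (_⊎_; inj₁; inj₂)
open import Data.List using (List; []; _∷_; map; foldr; tabulate; allFin; concatMap)
open import Data.List.Properties using (foldr-++)
open import Data.List.Relation.Unary.All as All using ()
open import Data.List.Relation.Unary.AllPairs using (_∷_)
open import Data.List.Relation.Unary.Any using (here; there)
open import Data.List.Relation.Unary.Unique.Propositional using (Unique)
open import Data.List.Relation.Unary.Unique.Propositional.Properties as Unique using (allFin⁺)
open import Data.List.Membership.Propositional using () renaming (_∈_ to _∈ˡ_; _∉_ to _∉ˡ_)
open import Data.List.Membership.Propositional.Properties using (∈-allFin; ∈-map⁺; ∈-map⁻)
open import Function using (_∘_; id)
open import Function.Bundles using (_⇔_; mk⇔; Equivalence)
open import Function.Properties.Equivalence using (⇔-setoid) renaming (trans to ⇔-trans; sym to ⇔-sym)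
open import Level using (0ℓ)
import Relation.Binary.Reasoning.Setoid
import Relation.Unary as U
open import Relation.Binary using (tri<; tri≈; tri>)
open import Relation.Nullary using (¬_; Dec; yes; no; contradiction)
open import Relation.Nullary.Decidable using (_×-dec_)
open import Relation.Binary.PropositionalEquality
  using (_≡_; _≢_; refl; sym; trans; cong; subst; subst₂; ≢-sym)

open Equivalence using (to; from)

module ⇔-Reasoning = Relation.Binary.Reasoning.Setoid (⇔-setoid 0ℓ)

≡⇒⇔ : ∀ {b c : Bool} → b ≡ c → (b ≡ true) ⇔ (c ≡ true)
≡⇒⇔ refl = mk⇔ (λ t → t) (λ t → t)

not≡true⇔≡false : ∀ {b} → (not b ≡ true) ⇔ (b ≡ false)
not≡true⇔≡false = ⇔-trans (⇔-sym T-≡) T-not-≡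

module _ {P : ℕ → Set} (P? : U.Decidable P) where

  least-witness : ∀ k {n} → n < k → P n → ∃ λ l → P l × (∀ n → P n → l ≤ n)
  least-witness (suc k) {n} n<1+k Pn with anyUpTo? P? k
  ... | yes (n′ , n′<k , Pn′) = least-witness k n′<k Pn′
  ... | no none = n , Pn , λ n′ Pn′ →
        ≤-trans (m<1+n⇒m≤n n<1+k) (≮⇒≥ λ n′<k → none (n′ , n′<k , Pn′))

  greatest-witness : ∀ k {n} → n < k → P n → ∃ λ h → P h × (∀ n → n < k → P n → n ≤ h)
  greatest-witness (suc k) {n} n<1+k Pn with P? k
  ... | yes Pk = k , Pk , λ _ n′<1+k _ → m<1+n⇒m≤n n′<1+k
  ... | no ¬Pk with greatest-witness k (≤∧≢⇒< (m<1+n⇒m≤n n<1+k) λ { refl → ¬Pk Pn }) Pn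
  ...   | h , Ph , h-max = h , Ph , bound
    where
    bound : ∀ n′ → n′ < suc k → P n′ → n′ ≤ h
    bound n′ n′<1+k Pn′ with m≤n⇒m<n∨m≡n (m<1+n⇒m≤n n′<1+k)
    ... | inj₁ n′<k = h-max n′ n′<k Pn′
    ... | inj₂ refl = contradiction Pn′ ¬Pk

module OrdinalSum (m : ℕ) (a : Fin (suc m) → ℕ) where
  open Poset m a hiding (_≤_)

  rank : Elem → ℕ
  rank = toℕ ∘ level

  rank< : ∀ z → rank z < suc m
  rank< z = Fin.toℕ<n (level z)

  rank≤m : ∀ z → rank z ≤ m
  rank≤m z = m<1+n⇒m≤n (rank< z)

  rank≡m⇒top : ∀ z → rank z ≡ m → level z ≡ top
  rank≡m⇒top z r = Fin.toℕ-injective (trans r (sym (Fin.toℕ-fromℕ m)))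

  rank<⇒≢ : ∀ {u v} → rank u < rank v → u ≢ v
  rank<⇒≢ p refl = <-irrefl refl p

  ∃Elem? : {Q : Elem → Set} → (∀ x → Dec (Q x)) → Dec (∃ Q)
  ∃Elem? Q? with Fin.any? (λ i → Fin.any? (λ j → Q? (i , j)))
  ... | yes (i , j , q) = yes ((i , j) , q)
  ... | no none = no λ { ((i , j) , q) → none (i , j , q) }

  Convex : Subset → Set
  Convex J = ∀ x y z → x ∈ J → y ∈ J → rank x < rank z → rank z < rank y → z ∈ J

  IsIC⇒Convex : ∀ {J} → IsIC J → Convex J
  IsIC⇒Convex ic x y z x∈ y∈ p q = ic x y z x∈ y∈ (inj₂ p) (inj₂ q)

  Convex⇒IsIC : ∀ {J} → Convex J → IsIC J
  Convex⇒IsIC c x y z x∈ y∈ (inj₁ refl) _           = x∈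
  Convex⇒IsIC c x y z x∈ y∈ (inj₂ _)    (inj₁ refl) = y∈
  Convex⇒IsIC c x y z x∈ y∈ (inj₂ p)    (inj₂ q)    = c x y z x∈ y∈ p q

  -- For a convex set with part B below rank k and part A above it, Gap says that an
  -- element of rank k cannot be removed, Extendable that it can be added.
  Gap : (B A : Elem → Set) → ℕ → Set
  Gap B A k = (∃ λ u → B u × rank u < k) × (∃ λ v → A v × k < rank v)

  Extendable : (B A : Elem → Set) → ℕ → Set
  Extendable B A k = (∀ u w → B u → rank u < rank w → rank w < k → B w)
                   × (∀ v w → A v → k < rank w → rank w < rank v → A w)

  RowRule : (B A : Elem → Set) → Bool → ℕ → Set
  RowRule B A b k = (b ≡ true × Gap B A k) ⊎ (b ≡ false × Extendable B A k)

  EquivBelow EquivAbove : ℕ → (B B′ : Elem → Set) → Set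
  EquivBelow k B B′ = ∀ u → rank u < k → B u ⇔ B′ u
  EquivAbove k A A′ = ∀ v → k < rank v → A v ⇔ A′ v

  module _ {B B′ A A′ : Elem → Set} {k : ℕ} (B≈ : EquivBelow k B B′) (A≈ : EquivAbove k A A′) where

    Gap-map : Gap B A k → Gap B′ A′ k
    Gap-map ((u , Bu , u<k) , (v , Av , k<v)) = (u , to (B≈ u u<k) Bu , u<k) , (v , to (A≈ v k<v) Av , k<v)

    Extendable-map : Extendable B A k → Extendable B′ A′ k
    Extendable-map (closedB , closedA) =
      (λ u w Bu p q → to (B≈ w q) (closedB u w (from (B≈ u (<-trans p q)) Bu) p q)) ,
      (λ v w Av p q → to (A≈ w p) (closedA v w (from (A≈ v (<-trans p q)) Av) p q))

  RowRule-cong : ∀ {B B′ A A′ b b′ k} → b ≡ b′ → EquivBelow k B B′ → EquivAbove k A A′ →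
                 RowRule B A b k ⇔ RowRule B′ A′ b′ k
  RowRule-cong refl B≈ A≈ =
    mk⇔ (forth B≈ A≈) (forth (λ u p → ⇔-sym (B≈ u p)) (λ v p → ⇔-sym (A≈ v p)))
    where
    forth : ∀ {B B′ A A′ b k} → EquivBelow k B B′ → EquivAbove k A A′ →
            RowRule B A b k → RowRule B′ A′ b k
    forth B≈ A≈ (inj₁ (b , gap)) = inj₁ (b , Gap-map B≈ A≈ gap)
    forth B≈ A≈ (inj₂ (b , ext)) = inj₂ (b , Extendable-map B≈ A≈ ext)

  RowRule-cong-off : ∀ {K J : Subset} {b b′ k} → b ≡ b′ → (∀ y → rank y ≢ k → K y ≡ J y) →
                     RowRule (_∈ K) (_∈ K) b k ⇔ RowRule (_∈ J) (_∈ J) b′ k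
  RowRule-cong-off b≡b′ K≡J =
    RowRule-cong b≡b′ (λ u p → ≡⇒⇔ (K≡J u (<⇒≢ p)))
                      (λ v p → ≡⇒⇔ (K≡J v (≢-sym (<⇒≢ p))))

  flipAt-self : ∀ x J → flipAt x J x ≡ not (J x)
  flipAt-self x J with x ≟ x
  ... | yes _  = refl
  ... | no x≢x = contradiction refl x≢x

  flipAt-≢ : ∀ {x y} J → y ≢ x → flipAt x J y ≡ J y
  flipAt-≢ {x} {y} J y≢x with y ≟ x
  ... | yes y≡x = contradiction y≡x y≢x
  ... | no _    = refl

  flipAt-∈ : ∀ {x y} J → x ≢ y → flipAt x J y ≡ true → y ∈ J
  flipAt-∈ J x≢y y∈ = trans (sym (flipAt-≢ J (≢-sym x≢y))) y∈

  removal-⊆ : ∀ {x y} J → x ∈ J → flipAt x J y ≡ true → y ∈ J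
  removal-⊆ {x} {y} J x∈ y∈ with y ≟ x
  ... | yes refl = contradiction (sym y∈) (not-¬ (sym x∈))
  ... | no _     = y∈

  addition-⊆ : ∀ {x y} J → flipAt x J y ≡ true → y ≡ x ⊎ y ∈ J
  addition-⊆ {x} {y} J y∈ with y ≟ x
  ... | yes y≡x = inj₁ y≡x
  ... | no _    = inj₂ y∈

  addition-⊇ : ∀ {x y} J → J x ≡ false → y ∈ J → flipAt x J y ≡ true
  addition-⊇ {x} {y} J x∉ y∈ with y ≟ x
  ... | yes refl = contradiction (trans (sym x∉) y∈) λ ()
  ... | no _     = y∈

  removal-convex⇔¬Gap : ∀ {x} J → x ∈ J → Convex J →
                        Convex (flipAt x J) ⇔ (¬ Gap (_∈ J) (_∈ J) (rank x))
  removal-convex⇔¬Gap {x} J x∈ cJ = mk⇔ blocked allowed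
    where
    x∉flip : flipAt x J x ≢ true
    x∉flip x∈flip = not-¬ (sym x∈) (trans (sym x∈flip) (flipAt-self x J))

    blocked : Convex (flipAt x J) → ¬ Gap (_∈ J) (_∈ J) (rank x)
    blocked cF ((u , u∈ , u<x) , (v , v∈ , x<v)) =
      x∉flip (cF u v x (trans (flipAt-≢ J (rank<⇒≢ u<x)) u∈)
                       (trans (flipAt-≢ J (≢-sym (rank<⇒≢ x<v))) v∈) u<x x<v)

    allowed : ¬ Gap (_∈ J) (_∈ J) (rank x) → Convex (flipAt x J)
    allowed noGap u v z u∈ v∈ p q with z ≟ x
    ... | yes refl = contradiction ((u , removal-⊆ J x∈ u∈ , p) , (v , removal-⊆ J x∈ v∈ , q)) noGap
    ... | no _     = cJ u v z (removal-⊆ J x∈ u∈) (removal-⊆ J x∈ v∈) p q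

  addition-convex⇔Extendable : ∀ {x} J → J x ≡ false → Convex J →
                               Convex (flipAt x J) ⇔ Extendable (_∈ J) (_∈ J) (rank x)
  addition-convex⇔Extendable {x} J x∉ cJ = mk⇔ extendable allowed
    where
    x∈flip : flipAt x J x ≡ true
    x∈flip = trans (flipAt-self x J) (cong not x∉)

    extendable : Convex (flipAt x J) → Extendable (_∈ J) (_∈ J) (rank x)
    extendable cF =
      (λ u w u∈ p q → flipAt-∈ J (≢-sym (rank<⇒≢ q)) (cF u x w (addition-⊇ J x∉ u∈) x∈flip p q)) ,
      (λ v w v∈ p q → flipAt-∈ J (rank<⇒≢ p) (cF x v w x∈flip (addition-⊇ J x∉ v∈) p q))

    allowed : Extendable (_∈ J) (_∈ J) (rank x) → Convex (flipAt x J)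
    allowed (closedBelow , closedAbove) u v z u∈ v∈ p q
      with addition-⊆ {x} {u} J u∈ | addition-⊆ {x} {v} J v∈
    ... | inj₁ refl | inj₁ refl = contradiction q (<-asym p)
    ... | inj₁ refl | inj₂ v∈J  = addition-⊇ J x∉ (closedAbove v z v∈J p q)
    ... | inj₂ u∈J  | inj₁ refl = addition-⊇ J x∉ (closedBelow u z u∈J p q)
    ... | inj₂ u∈J  | inj₂ v∈J  = addition-⊇ J x∉ (cJ u v z u∈J v∈J p q)

  Gap? : ∀ J k → Dec (Gap (_∈ J) (_∈ J) k)
  Gap? J k = ∃Elem? (λ u → (J u Data.Bool.≟ true) ×-dec (rank u ℕ.<? k))
       ×-dec ∃Elem? (λ v → (J v Data.Bool.≟ true) ×-dec (k ℕ.<? rank v))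

  -- Opaque, so that conversion checking never unfolds the decision procedure isIC? inside toggle.
  opaque
    toggleᵒ : Elem → Subset → Subset
    toggleᵒ = toggle

    Row≡foldr-toggleᵒ : ∀ I → Row I ≡ foldr toggleᵒ I linExt
    Row≡foldr-toggleᵒ I = refl

    toggleᵒ-≢ : ∀ x J y → y ≢ x → toggleᵒ x J y ≡ J y
    toggleᵒ-≢ x J y y≢x with isIC? (flipAt x J)
    ... | yes _ = flipAt-≢ J y≢x
    ... | no _  = refl

    toggleᵒ-convex : ∀ x J → Convex J → Convex (toggleᵒ x J)
    toggleᵒ-convex x J cJ with isIC? (flipAt x J)
    ... | yes ic = IsIC⇒Convex ic
    ... | no _   = cJ

    toggleᵒ-self : ∀ x J → Convex J → (toggleᵒ x J x ≡ true) ⇔ RowRule (_∈ J) (_∈ J) (J x) (rank x)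
    toggleᵒ-self x J cJ with isIC? (flipAt x J) | J x in x∈?
    ... | yes ic | true  = mk⇔
          (λ x∈flip → contradiction (trans (sym x∈flip) (flipAt-self x J)) (not-¬ (sym x∈?)))
          λ { (inj₁ (_ , gap)) → contradiction gap (to (removal-convex⇔¬Gap J x∈? cJ) (IsIC⇒Convex ic))
            ; (inj₂ (() , _)) }
    ... | yes ic | false = mk⇔
          (λ _ → inj₂ (refl , to (addition-convex⇔Extendable J x∈? cJ) (IsIC⇒Convex ic)))
          (λ _ → trans (flipAt-self x J) (cong not x∈?))
    ... | no ¬ic | true  = mk⇔ (λ _ → inj₁ (refl , gap)) (λ _ → x∈?)
      where
      gap : Gap (_∈ J) (_∈ J) (rank x)
      gap with Gap? J (rank x)
      ... | yes gap = gap
      ... | no noGap = contradiction (Convex⇒IsIC (from (removal-convex⇔¬Gap J x∈? cJ) noGap)) ¬ic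
    ... | no ¬ic | false = mk⇔ (λ x∈ → contradiction (trans (sym x∈?) x∈) λ ())
          λ { (inj₁ (() , _))
            ; (inj₂ (_ , ext)) →
                contradiction (Convex⇒IsIC (from (addition-convex⇔Extendable J x∈? cJ) ext)) ¬ic }

  -- Toggles at elements of equal rank commute: each one only looks at the other ranks.
  record Sweep (xs : List Elem) (J K : Subset) : Set where
    field
      convex  : Convex K
      outside : ∀ y → y ∉ˡ xs → K y ≡ J y
      inside  : ∀ x → x ∈ˡ xs → (K x ≡ true) ⇔ RowRule (_∈ J) (_∈ J) (J x) (rank x)

  sweep-step : ∀ {x xs J K} → (∀ y → y ∈ˡ x ∷ xs → rank y ≡ rank x) → x ∉ˡ xs →
               Sweep xs J K → Sweep (x ∷ xs) J (toggleᵒ x K)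
  sweep-step {x} {xs} {J} {K} rank≡ x∉xs K-sweep = record
    { convex = toggleᵒ-convex x K convex ; outside = outside′ ; inside = inside′ }
    where
    open Sweep K-sweep

    outside′ : ∀ y → y ∉ˡ x ∷ xs → toggleᵒ x K y ≡ J y
    outside′ y y∉ = trans (toggleᵒ-≢ x K y (λ y≡x → y∉ (here y≡x)))
                          (outside y (λ y∈ → y∉ (there y∈)))

    K≡J-off : ∀ y → rank y ≢ rank x → K y ≡ J y
    K≡J-off y ≢x = outside y (λ y∈ → ≢x (rank≡ y (there y∈)))

    inside′ : ∀ z → z ∈ˡ x ∷ xs → (toggleᵒ x K z ≡ true) ⇔ RowRule (_∈ J) (_∈ J) (J z) (rank z)
    inside′ z (here refl) = ⇔-trans (toggleᵒ-self x K convex) (RowRule-cong-off (outside x x∉xs) K≡J-off)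
    inside′ z (there z∈) = ⇔-trans (≡⇒⇔ {toggleᵒ x K z} {K z} (toggleᵒ-≢ x K z z≢x)) (inside z z∈)
      where
      z≢x : z ≢ x
      z≢x refl = x∉xs z∈

  sweep : ∀ {k} xs J → (∀ x → x ∈ˡ xs → rank x ≡ k) → Unique xs → Convex J →
          Sweep xs J (foldr toggleᵒ J xs)
  sweep [] J _ _ cJ = record { convex = cJ ; outside = λ _ _ → refl ; inside = λ _ () }
  sweep (x ∷ xs) J rank≡ (x≢xs ∷ unique) cJ =
    sweep-step {x} {xs} {J} {foldr toggleᵒ J xs} (λ y y∈ → trans (rank≡ y y∈) (sym (rank≡ x (here refl))))
               (λ x∈ → All.lookup x≢xs x∈ refl)
               (sweep xs J (λ y y∈ → rank≡ y (there y∈)) unique cJ)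

  levelElems : Fin (suc m) → List Elem
  levelElems i = map (i ,_) (allFin (a i))

  sweepLevel : Fin (suc m) → Subset → Subset
  sweepLevel i J = foldr toggleᵒ J (levelElems i)

  levelElems-rank : ∀ {i z} → z ∈ˡ levelElems i → rank z ≡ toℕ i
  levelElems-rank z∈ with ∈-map⁻ _ z∈
  ... | _ , _ , refl = refl

  rank≡⇒∈levelElems : ∀ {i} z → rank z ≡ toℕ i → z ∈ˡ levelElems i
  rank≡⇒∈levelElems (i′ , j) r with Fin.toℕ-injective r
  ... | refl = ∈-map⁺ _ (∈-allFin j)

  sweepLevel-sweep : ∀ i J → Convex J → Sweep (levelElems i) J (sweepLevel i J)
  sweepLevel-sweep i J =
    sweep (levelElems i) J (λ _ → levelElems-rank) (Unique.map⁺ (λ { refl → refl }) (allFin⁺ (a i)))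

  foldr-toggleᵒ-levelwise : ∀ is J → foldr toggleᵒ J (concatMap levelElems is) ≡ foldr sweepLevel J is
  foldr-toggleᵒ-levelwise []       J = refl
  foldr-toggleᵒ-levelwise (i ∷ is) J =
    trans (foldr-++ toggleᵒ J (levelElems i) _) (cong (sweepLevel i) (foldr-toggleᵒ-levelwise is J))

  Row-levelwise : ∀ I → Row I ≡ foldr sweepLevel I (allFin (suc m))
  Row-levelwise I = trans (Row≡foldr-toggleᵒ I) (foldr-toggleᵒ-levelwise (allFin (suc m)) I)

  SatisfiesRowRule : Subset → (Elem → Set) → Set
  SatisfiesRowRule I Q = ∀ z → Q z ⇔ RowRule (_∈ I) Q (I z) (rank z)

  Represents : Subset → (Elem → Set) → Set
  Represents S P = ∀ z → (S z ≡ true) ⇔ P z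

  module Characterisation (I : Subset) (cI : Convex I) (Q : Elem → Set)
           (Q-rule : SatisfiesRowRule I Q) where

    -- The set once the ranks t, t + 1, …, m have been toggled.
    Stage : ℕ → Elem → Set
    Stage t z = (rank z < t × z ∈ I) ⊎ (t ≤ rank z × Q z)

    Stage-below : ∀ {t u} → rank u < t → Stage t u ⇔ u ∈ I
    Stage-below u<t = mk⇔
      (λ { (inj₁ (_ , u∈)) → u∈ ; (inj₂ (t≤u , _)) → contradiction t≤u (<⇒≱ u<t) })
      (λ u∈ → inj₁ (u<t , u∈))

    Stage-above : ∀ {t v} → t ≤ rank v → Stage t v ⇔ Q v
    Stage-above t≤v = mk⇔
      (λ { (inj₁ (v<t , _)) → contradiction t≤v (<⇒≱ v<t) ; (inj₂ (_ , Qv)) → Qv })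
      (λ Qv → inj₂ (t≤v , Qv))

    Stage-suc : ∀ {t} z → rank z ≢ t → Stage (suc t) z ⇔ Stage t z
    Stage-suc {t} z z≢t with <-cmp (rank z) t
    ... | tri< z<t _ _ = ⇔-trans (Stage-below (m<n⇒m<1+n z<t)) (⇔-sym (Stage-below z<t))
    ... | tri≈ _ z≡t _ = contradiction z≡t z≢t
    ... | tri> _ _ t<z = ⇔-trans (Stage-above t<z) (⇔-sym (Stage-above (<⇒≤ t<z)))

    stage-step : ∀ {t} i S → toℕ i ≡ t → Convex S → Represents S (Stage (suc t)) →
                 Represents (sweepLevel i S) (Stage t)
    stage-step {t} i S i≡t cS S≈ z with rank z ℕ.≟ t
    ... | no z≢t = ⇔-trans (≡⇒⇔ (outside z (z≢t ∘ λ z∈ → trans (levelElems-rank z∈) i≡t)))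
                           (⇔-trans (S≈ z) (Stage-suc z z≢t))
      where open Sweep (sweepLevel-sweep i S cS)
    ... | yes z≡t = begin
      (sweepLevel i S z ≡ true)               ≈⟨ inside z (rank≡⇒∈levelElems z (trans z≡t (sym i≡t))) ⟩
      RowRule (_∈ S) (_∈ S) (S z) (rank z)   ≈⟨ RowRule-cong Sz≡Iz below above ⟩
      RowRule (_∈ I) Q (I z) (rank z)        ≈⟨ ⇔-sym (Q-rule z) ⟩
      Q z                                     ≈⟨ ⇔-sym (Stage-above (≤-reflexive (sym z≡t))) ⟩
      Stage t z                               ∎
      where
      open Sweep (sweepLevel-sweep i S cS)
      open ⇔-Reasoning
      z<1+t : rank z < suc t
      z<1+t = s≤s (≤-reflexive z≡t)
      Sz≡Iz : S z ≡ I z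
      Sz≡Iz = ⇔→≡ (⇔-trans (S≈ z) (Stage-below z<1+t))
      below : EquivBelow (rank z) (_∈ S) (_∈ I)
      below u u<z = ⇔-trans (S≈ u) (Stage-below (<-trans u<z z<1+t))
      above : EquivAbove (rank z) (_∈ S) Q
      above v z<v = ⇔-trans (S≈ v) (Stage-above (subst (_< rank v) z≡t z<v))

    stages : ∀ n t (g : Fin n → Fin (suc m)) → t + n ≡ suc m → (∀ j → toℕ (g j) ≡ t + toℕ j) →
             Convex (foldr sweepLevel I (tabulate g)) × Represents (foldr sweepLevel I (tabulate g)) (Stage t)
    stages zero t g t≡1+m _ = cI , λ z → ⇔-sym (Stage-below (rank<t z))
      where
      rank<t : ∀ z → rank z < t
      rank<t z = subst (rank z <_) (sym (trans (sym (+-identityʳ t)) t≡1+m)) (rank< z)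
    stages (suc n) t g t+n≡ g≡ =
      Sweep.convex (sweepLevel-sweep (g Fin.zero) S cS) ,
      stage-step (g Fin.zero) S (trans (g≡ Fin.zero) (+-identityʳ t)) cS S≈
      where
      S = foldr sweepLevel I (tabulate (g ∘ Fin.suc))
      rest = stages n (suc t) (g ∘ Fin.suc) (trans (sym (+-suc t n)) t+n≡)
                    (λ j → trans (g≡ (Fin.suc j)) (+-suc t (toℕ j)))
      cS = proj₁ rest
      S≈ = proj₂ rest

    Row-represents : Represents (Row I) Q
    Row-represents z = begin
      (Row I z ≡ true)                                  ≈⟨ ≡⇒⇔ (cong (λ S → S z) (Row-levelwise I)) ⟩
      (foldr sweepLevel I (allFin (suc m)) z ≡ true)    ≈⟨ proj₂ (stages (suc m) 0 id refl (λ _ → refl)) z ⟩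
      Stage 0 z                                          ≈⟨ Stage-above z≤n ⟩
      Q z                                                ∎
      where open ⇔-Reasoning

  Absent : Subset → Elem → Set
  Absent I z = I z ≡ false

  complement-rule : ∀ {I} → Convex I →
    (∀ z → z ∈ I → ¬ Gap (_∈ I) (Absent I) (rank z)) →
    (∀ z → Absent I z → Extendable (_∈ I) (Absent I) (rank z)) →
    SatisfiesRowRule I (Absent I)
  complement-rule {I} cI noGap ext z = mk⇔
    (λ z∉ → inj₂ (z∉ , ext z z∉))
    λ { (inj₁ (z∈ , gap)) → contradiction gap (noGap z z∈) ; (inj₂ (z∉ , _)) → z∉ }

  module Cases (nonempty : ∀ i → 1 ≤ a i) {I : Subset} (cI : Convex I) where

    elemAt : Fin (suc m) → Elem
    elemAt i = i , fromℕ< (nonempty i)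

    empty-rule : (∀ x → I x ≡ false) → SatisfiesRowRule I (Absent I)
    empty-rule empty = complement-rule cI
      (λ z z∈ _ → not-¬ (empty z) z∈)
      (λ z _ → (λ u _ u∈ _ _ → contradiction u∈ (not-¬ (empty u))) , (λ _ w _ _ _ → empty w))

    top⊆-rule : (∀ j → (top , j) ∈ I) → SatisfiesRowRule I (Absent I)
    top⊆-rule top⊆ = complement-rule cI
      (λ { z z∈ (_ , (v , v∉ , z<v)) → not-¬ v∉ (∈-above z∈ z<v) })
      (λ z _ → (λ u w u∈ u<w _ → ∈-above u∈ u<w) ,
               (λ v w v∉ _ w<v → ¬-not (λ w∈ → not-¬ v∉ (∈-above w∈ w<v))))
      where
      top∈ : ∀ v → rank v ≡ m → v ∈ I
      top∈ (i , j) r with rank≡m⇒top (i , j) r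
      ... | refl = top⊆ j
      ∈-above : ∀ {u w} → u ∈ I → rank u < rank w → w ∈ I
      ∈-above {u} {w} u∈ u<w with rank w ℕ.≟ m
      ... | yes w≡m = top∈ w w≡m
      ... | no w≢m  = cI u (elemAt top) w u∈ (top∈ (elemAt top) (Fin.toℕ-fromℕ m)) u<w
                         (subst (rank w <_) (sym (Fin.toℕ-fromℕ m)) (≤∧≢⇒< (rank≤m w) w≢m))

    ⊆top-rule : (∀ x → x ∈ I → level x ≡ top) → SatisfiesRowRule I (Absent I)
    ⊆top-rule ⊆top = complement-rule cI
      (λ { z z∈ (_ , (v , _ , z<v)) → ¬>m z∈ v z<v })
      (λ z _ → (λ u w u∈ u<w _ → contradiction u<w (¬>m u∈ w)) ,
               (λ v w _ _ w<v → ¬-not (λ w∈ → ¬>m w∈ v w<v)))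
      where
      ¬>m : ∀ {u} → u ∈ I → ∀ v → ¬ rank u < rank v
      ¬>m {u} u∈ v u<v =
        <⇒≱ (subst (_< rank v) (trans (cong toℕ (⊆top u u∈)) (Fin.toℕ-fromℕ m)) u<v) (rank≤m v)

    special-rule : SpecialCase I → SatisfiesRowRule I (Absent I)
    special-rule (inj₁ empty)        = empty-rule empty
    special-rule (inj₂ (inj₁ top⊆)) = top⊆-rule top⊆
    special-rule (inj₂ (inj₂ ⊆top)) = ⊆top-rule ⊆top

    Occupied : ℕ → Set
    Occupied l = ∃ λ x → x ∈ I × rank x ≡ l

    Occupied? : U.Decidable Occupied
    Occupied? l = ∃Elem? (λ x → (I x Data.Bool.≟ true) ×-dec (rank x ℕ.≟ l))

    record Extent : Set where
      field
        L H : ℕ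
        bottom summit : Elem
        bottom∈ : bottom ∈ I
        summit∈ : summit ∈ I
        rank-bottom : rank bottom ≡ L
        rank-summit : rank summit ≡ H
        L-least : ∀ s → s ∈ I → L ≤ rank s
        H-greatest : ∀ s → s ∈ I → rank s ≤ H

    extent : ∀ {x} → x ∈ I → Extent
    extent {x} x∈ with least-witness Occupied? (suc m) (rank< x) (x , x∈ , refl)
                     | greatest-witness Occupied? (suc m) (rank< x) (x , x∈ , refl)
    ... | L , (b , b∈ , rank-b) , L-min | H , (s , s∈ , rank-s) , H-max = record
      { L = L ; H = H ; bottom = b ; summit = s ; bottom∈ = b∈ ; summit∈ = s∈
      ; rank-bottom = rank-b ; rank-summit = rank-s
      ; L-least = λ y y∈ → L-min (rank y) (y , y∈ , refl)
      ; H-greatest = λ y y∈ → H-max (rank y) (rank< y) (y , y∈ , refl) }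

    -- Then Min I is I at rank L, and Ceil I is the complement of I at rank C.
    record Profile : Set where
      field
        L C : ℕ
        bottom hole : Elem
        bottom∈ : bottom ∈ I
        rank-bottom : rank bottom ≡ L
        L-least : ∀ s → s ∈ I → L ≤ rank s
        hole∉ : Absent I hole
        rank-hole : rank hole ≡ C
        L<C : L < C
        full : ∀ w → L < rank w → rank w < C → w ∈ I

    HoleAt : ℕ → Set
    HoleAt k = ∃ λ y → rank y ≡ k × Absent I y

    module FromExtent (¬special : ¬ SpecialCase I) (e : Extent) where
      open Extent e

      L≤H : L ≤ H
      L≤H = subst (L ≤_) rank-summit (L-least summit summit∈)

      full-below-H : ∀ w → L < rank w → rank w < H → w ∈ I
      full-below-H w L<w w<H =
        cI bottom summit w bottom∈ summit∈ (subst (_< rank w) (sym rank-bottom) L<w)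
                                         (subst (rank w <_) (sym rank-summit) w<H)

      profile-at-H : L < H → HoleAt H → Profile
      profile-at-H L<H (y , rank-y , y∉) = record
        { L = L ; C = H ; bottom = bottom ; hole = y ; bottom∈ = bottom∈ ; rank-bottom = rank-bottom
        ; L-least = L-least ; hole∉ = y∉ ; rank-hole = rank-y ; L<C = L<H ; full = full-below-H }

      -- H = m would make I contain the top level (if L < H) or lie inside it (if L = H).
      H<m : ¬ (L < H × HoleAt H) → H < m
      H<m ¬hole = ≤∧≢⇒< (subst (_≤ m) rank-summit (rank≤m summit)) H≢m
        where
        H≢m : H ≢ m
        H≢m refl with L <? H
        ... | yes L<H = ¬special (inj₂ (inj₁ λ j →
                          ¬-not λ top∉ → ¬hole (L<H , (top , j) , Fin.toℕ-fromℕ m , top∉)))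
        ... | no L≮H  = ¬special (inj₂ (inj₂ λ x x∈ → rank≡m⇒top x (≤-antisym (rank≤m x)
                          (subst (_≤ rank x) (≤-antisym L≤H (≮⇒≥ L≮H)) (L-least x x∈)))))

      profile-above-H : ¬ (L < H × HoleAt H) → Profile
      profile-above-H ¬hole = record
        { L = L ; C = suc H ; bottom = bottom ; hole = elemAt next ; bottom∈ = bottom∈
        ; rank-bottom = rank-bottom ; L-least = L-least ; hole∉ = next∉ ; rank-hole = Fin.toℕ-fromℕ< 1+H<1+m
        ; L<C = s≤s L≤H ; full = full }
        where
        1+H<1+m : suc H < suc m
        1+H<1+m = s≤s (H<m ¬hole)
        next = fromℕ< 1+H<1+m
        next∉ : Absent I (elemAt next)
        next∉ = ¬-not λ next∈ →
          <-irrefl refl (subst (_≤ H) (Fin.toℕ-fromℕ< 1+H<1+m) (H-greatest (elemAt next) next∈))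
        full : ∀ w → L < rank w → rank w < suc H → w ∈ I
        full w L<w w<1+H with m≤n⇒m<n∨m≡n (m<1+n⇒m≤n w<1+H)
        ... | inj₁ w<H  = full-below-H w L<w w<H
        ... | inj₂ w≡H = ¬-not λ w∉ → ¬hole (subst (L <_) w≡H L<w , w , w≡H , w∉)

      profile : Profile
      profile with L <? H ×-dec ∃Elem? (λ y → (rank y ℕ.≟ H) ×-dec (I y Data.Bool.≟ false))
      ... | yes (L<H , hole) = profile-at-H L<H hole
      ... | no ¬hole         = profile-above-H ¬hole

    profile : ¬ SpecialCase I → Profile
    profile ¬special with ∃Elem? (λ x → I x Data.Bool.≟ true)
    ... | no I-empty  = contradiction (inj₁ λ x → ¬-not λ x∈ → I-empty (x , x∈)) ¬special
    ... | yes (_ , x∈) = FromExtent.profile ¬special (extent x∈)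

    module FromProfile (p : Profile) where
      open Profile p

      Band : Elem → Set
      Band z = L ≤ rank z × rank z ≤ C × (rank z ≡ L ⊎ rank z ≡ C → Absent I z)

      bottom<hole : rank bottom < rank hole
      bottom<hole = subst₂ _<_ (sym rank-bottom) (sym rank-hole) L<C

      hole-Band : Band hole
      hole-Band = subst (L ≤_) (sym rank-hole) (<⇒≤ L<C) , ≤-reflexive rank-hole , λ _ → hole∉

      Band-rule-∈ : ∀ {z} → z ∈ I → Band z ⇔ RowRule (_∈ I) Band (I z) (rank z)
      Band-rule-∈ {z} z∈ = mk⇔ forth back
        where
        forth : Band z → RowRule (_∈ I) Band (I z) (rank z)
        forth (L≤z , z≤C , ends) = inj₁ (z∈ , (bottom , bottom∈ , subst (_< rank z) (sym rank-bottom) L<z) ,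
                                              (hole , hole-Band , subst (rank z <_) (sym rank-hole) z<C))
          where
          L<z = ≤∧≢⇒< L≤z λ L≡z → not-¬ (ends (inj₁ (sym L≡z))) z∈
          z<C = ≤∧≢⇒< z≤C λ z≡C → not-¬ (ends (inj₂ z≡C)) z∈
        back : RowRule (_∈ I) Band (I z) (rank z) → Band z
        back (inj₂ (z∉ , _)) = contradiction z∈ (not-¬ z∉)
        back (inj₁ (_ , ((u , u∈ , u<z) , (v , (_ , v≤C , _) , z<v)))) =
          L≤z , <⇒≤ z<C , λ { (inj₁ z≡L) → contradiction L<z (<-irrefl (sym z≡L))
                             ; (inj₂ z≡C) → contradiction z<C (<-irrefl z≡C) }
          where
          L<z = ≤-<-trans (L-least u u∈) u<z
          L≤z = <⇒≤ L<z
          z<C = <-≤-trans z<v v≤C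

      Band-rule-∉ : ∀ {z} → Absent I z → Band z ⇔ RowRule (_∈ I) Band (I z) (rank z)
      Band-rule-∉ {z} z∉ = mk⇔ forth back
        where
        forth : Band z → RowRule (_∈ I) Band (I z) (rank z)
        forth (L≤z , z≤C , _) = inj₂ (z∉ , closedBelow , closedAbove)
          where
          closedBelow : ∀ u w → u ∈ I → rank u < rank w → rank w < rank z → w ∈ I
          closedBelow u w u∈ u<w w<z = full w (≤-<-trans (L-least u u∈) u<w) (<-≤-trans w<z z≤C)
          closedAbove : ∀ v w → Band v → rank z < rank w → rank w < rank v → Band w
          closedAbove v w (_ , v≤C , _) z<w w<v =
            <⇒≤ L<w , <⇒≤ w<C ,
            λ { (inj₁ w≡L) → contradiction L<w (<-irrefl (sym w≡L))
              ; (inj₂ w≡C) → contradiction w<C (<-irrefl w≡C) }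
            where
            L<w = ≤-<-trans L≤z z<w
            w<C = <-≤-trans w<v v≤C
        back : RowRule (_∈ I) Band (I z) (rank z) → Band z
        back (inj₁ (z∈ , _)) = contradiction z∈ (not-¬ z∉)
        back (inj₂ (_ , closedBelow , closedAbove)) = L≤z , z≤C , λ _ → z∉
          where
          -- otherwise convexity would put bottom into Band, or hole into I
          L≤z = ≮⇒≥ λ z<L → not-¬ (proj₂ (proj₂ (closedAbove hole bottom hole-Band
                  (subst (rank z <_) (sym rank-bottom) z<L) bottom<hole)) (inj₁ rank-bottom)) bottom∈
          z≤C = ≮⇒≥ λ C<z → not-¬ hole∉ (closedBelow bottom hole bottom∈ bottom<hole
                  (subst (_< rank z) (sym rank-hole) C<z))

      Band-rule : SatisfiesRowRule I Band
      Band-rule z with I z Data.Bool.≟ true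
      ... | yes z∈ = Band-rule-∈ z∈
      ... | no z∉  = Band-rule-∉ (¬-not z∉)

      Min⇔ : ∀ x → Min I x ⇔ (x ∈ I × rank x ≡ L)
      Min⇔ x = mk⇔ forth back
        where
        forth : Min I x → x ∈ I × rank x ≡ L
        forth (x∈ , minimal) = x∈ , ≤-antisym (≮⇒≥ L≮x) (L-least x x∈)
          where
          L≮x : ¬ L < rank x
          L≮x L<x = <-irrefl (cong rank (minimal bottom bottom∈ (inj₂ bottom<x))) bottom<x
            where bottom<x = subst (_< rank x) (sym rank-bottom) L<x
        back : x ∈ I × rank x ≡ L → Min I x
        back (x∈ , x≡L) = x∈ , λ
          { y y∈ (inj₁ y≡x) → y≡x
          ; y y∈ (inj₂ y<x) → contradiction (L-least y y∈) (<⇒≱ (subst (rank y <_) x≡L y<x)) }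

      Ceil⇔ : ∀ x → Ceil I x ⇔ (rank x ≡ C × Absent I x)
      Ceil⇔ x = mk⇔ forth back
        where
        forth : Ceil I x → rank x ≡ C × Absent I x
        forth (((s , s∈ , inj₁ refl) , x∉) , _) = contradiction s∈ x∉
        forth (((s , s∈ , inj₂ s<x) , x∉) , minimal) = ≤-antisym x≤C C≤x , ¬-not x∉
          where
          C≤x = ≮⇒≥ λ x<C → x∉ (full x (≤-<-trans (L-least s s∈) s<x) x<C)
          x≤C = ≮⇒≥ λ C<x →
            let hole<x = subst (_< rank x) (sym rank-hole) C<x in
            <-irrefl (cong rank (minimal hole (bottom , bottom∈ , inj₂ bottom<hole)
                                          (not-¬ hole∉) (inj₂ hole<x)))
                     hole<x
        back : rank x ≡ C × Absent I x → Ceil I x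
        back (x≡C , x∉) =
          ((bottom , bottom∈ , inj₂ (subst (rank bottom <_) (trans rank-hole (sym x≡C)) bottom<hole)) ,
           not-¬ x∉) ,
          λ { y _ _ (inj₁ y≡x) → y≡x
            ; y (s , s∈ , inj₁ refl) y∉ (inj₂ _) → contradiction s∈ y∉
            ; y (s , s∈ , inj₂ s<y) y∉ (inj₂ y<x) →
                contradiction (full y (≤-<-trans (L-least s s∈) s<y) (subst (rank y <_) x≡C y<x)) y∉ }

      Δ-Min⇔ : ∀ z → Δ (Min I) z ⇔ (rank z < L ⊎ (rank z ≡ L × z ∈ I))
      Δ-Min⇔ z = mk⇔ forth back
        where
        forth : Δ (Min I) z → rank z < L ⊎ (rank z ≡ L × z ∈ I)
        forth (s , ms , inj₁ refl) = inj₂ (proj₂ (to (Min⇔ s) ms) , proj₁ (to (Min⇔ s) ms))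
        forth (s , ms , inj₂ z<s) = inj₁ (subst (rank z <_) (proj₂ (to (Min⇔ s) ms)) z<s)
        back : rank z < L ⊎ (rank z ≡ L × z ∈ I) → Δ (Min I) z
        back (inj₁ z<L) = bottom , from (Min⇔ bottom) (bottom∈ , rank-bottom) ,
                          inj₂ (subst (rank z <_) (sym rank-bottom) z<L)
        back (inj₂ (z≡L , z∈)) = z , from (Min⇔ z) (z∈ , z≡L) , inj₁ refl

      Δ-Ceil⇔ : ∀ z → Δ (Ceil I) z ⇔ (rank z < C ⊎ (rank z ≡ C × Absent I z))
      Δ-Ceil⇔ z = mk⇔ forth back
        where
        forth : Δ (Ceil I) z → rank z < C ⊎ (rank z ≡ C × Absent I z)
        forth (s , cs , inj₁ refl) = inj₂ (to (Ceil⇔ s) cs)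
        forth (s , cs , inj₂ z<s) = inj₁ (subst (rank z <_) (proj₁ (to (Ceil⇔ s) cs)) z<s)
        back : rank z < C ⊎ (rank z ≡ C × Absent I z) → Δ (Ceil I) z
        back (inj₁ z<C) = hole , from (Ceil⇔ hole) (rank-hole , hole∉) ,
                          inj₂ (subst (rank z <_) (sym rank-hole) z<C)
        back (inj₂ ceil) = z , from (Ceil⇔ z) ceil , inj₁ refl

      Band⇔ΔCeil-ΔMin : ∀ z → Band z ⇔ (Δ (Ceil I) z × ¬ Δ (Min I) z)
      Band⇔ΔCeil-ΔMin z = mk⇔ forth back
        where
        forth : Band z → Δ (Ceil I) z × ¬ Δ (Min I) z
        forth (L≤z , z≤C , ends) = from (Δ-Ceil⇔ z) belowCeil , notBelowMin
          where
          belowCeil : rank z < C ⊎ (rank z ≡ C × Absent I z)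
          belowCeil with m≤n⇒m<n∨m≡n z≤C
          ... | inj₁ z<C = inj₁ z<C
          ... | inj₂ z≡C = inj₂ (z≡C , ends (inj₂ z≡C))
          notBelowMin : ¬ Δ (Min I) z
          notBelowMin d with to (Δ-Min⇔ z) d
          ... | inj₁ z<L        = <⇒≱ z<L L≤z
          ... | inj₂ (z≡L , z∈) = not-¬ (ends (inj₁ z≡L)) z∈
        back : Δ (Ceil I) z × ¬ Δ (Min I) z → Band z
        back (dc , ¬dm) =
          ≮⇒≥ (λ z<L → ¬dm (from (Δ-Min⇔ z) (inj₁ z<L))) , z≤C (to (Δ-Ceil⇔ z) dc) , ends
          where
          z≤C : rank z < C ⊎ (rank z ≡ C × Absent I z) → rank z ≤ C
          z≤C (inj₁ z<C)     = <⇒≤ z<C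
          z≤C (inj₂ (z≡C , _)) = ≤-reflexive z≡C
          ends : rank z ≡ L ⊎ rank z ≡ C → Absent I z
          ends (inj₁ z≡L) = ¬-not λ z∈ → ¬dm (from (Δ-Min⇔ z) (inj₂ (z≡L , z∈)))
          ends (inj₂ z≡C) with to (Δ-Ceil⇔ z) dc
          ... | inj₁ z<C       = contradiction z<C (<-irrefl z≡C)
          ... | inj₂ (_ , z∉) = z∉

theorem3p14 : (m : ℕ) (a : Fin (suc m) → ℕ) → (∀ i → 1 ≤ a i) →
    let open Poset m a in
    (I : Subset) → IsIC I →
      (SpecialCase I → ∀ z → Row I z ≡ not (I z))
      × (¬ SpecialCase I →
           ∀ z → (Row I z ≡ true) ⇔ (Δ (Ceil I) z × ¬ Δ (Min I) z))
theorem3p14 m a nonempty I ic = special , generic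
  where
  open Poset m a using (SpecialCase; Row; Δ; Ceil; Min)
  open OrdinalSum m a
  open Cases nonempty (IsIC⇒Convex ic)
  open Characterisation I (IsIC⇒Convex ic)

  special : SpecialCase I → ∀ z → Row I z ≡ not (I z)
  special sc z = ⇔→≡ (⇔-trans (Row-represents (Absent I) (special-rule sc) z) (⇔-sym not≡true⇔≡false))

  generic : ¬ SpecialCase I → ∀ z → (Row I z ≡ true) ⇔ (Δ (Ceil I) z × ¬ Δ (Min I) z)
  generic ¬sc z = ⇔-trans (Row-represents Band Band-rule z) (Band⇔ΔCeil-ΔMin z)
    where open FromProfile (profile ¬sc)
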